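{- Let $(G,k)$ be an instance of Diamond-free Edge Deletion to which none of the Phase 1 rules applies, and let $X$, $V_X$ (with $|V_X|\le 4k$), $\mathcal{C}$ be as described in the context. Let $C\in\mathcal{C}$ with $|C|\geq 3$. Then the number of vertices of $C$ that are adjacent to at least one vertex of $B_C\cup D_C$ is at most $4k-1$.
   Context: A diamond is $K_4$ minus an edge. Diamond-free Edge Deletion asks, for $(G,k)$, whether some $F\subseteq E(G)$, $|F|\le k$, makes $G-F$ free of induced diamonds. A core member is a vertex/edge lying in a (not necessarily induced) diamond subgraph of $G$. Phase 1 rules: (Irrelevant edge) delete an edge that is not a core member; (Sunflower) if $\{x,y\}\in E(G)$ and $G[N(x)\cap N(y)]$ has $k+1$ pairwise vertex-disjoint non-edges, delete $\{x,y\}$ and decrease $k$; (Vertex-split) if $G[N(v)]$ has components $V_1,\dots,V_t$, $t>1$, replace $v$ by new vertices $v_1,\dots,v_t$ with $N(v_i)=V_i$; (Irrelevant component) delete a connected component with no induced diamond. $X\subseteq E(G)$ is the union of the edge sets of a maximal family of at most $k$ pairwise edge-disjoint induced diamonds of $G$ (so every induced diamond of $G$ has an edge in $X$); $V_X$ is the set of endpoints of edges of $X$ ($|V_X|\le4k$); $\mathcal{C}$ is the set of vertex sets of maximal cliques of the diamond-free graph $G-V_X$. For $C\in\mathcal{C}$: $B_C$ is the set of vertices of $V(G)\setminus(V_X\cup C)$ adjacent to exactly one vertex of $C$; $D_C$ is the set of vertices of $V_X$ adjacent to exactly one vertex of $C$. -}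

module Defs where

open import Data.Nat using (ℕ; suc; _≤_; _<_; _*_; _≡ᵇ_)
open import Data.Bool using (Bool; true; false; T; not; _∧_)
open import Data.Fin using (Fin)
open import Data.Fin.Subset using (Subset; _∈_; _∉_; _∩_; _∪_; ∣_∣)
open import Data.Vec using (tabulate; lookup)
open import Data.List using (allFin)
open import Data.Bool.ListAction using (any)
open import Data.Product using (Σ; ∃; _×_; _,_)
open import Data.Sum using (_⊎_)
open import Data.Unit using (⊤)
open import Relation.Nullary using (¬_)
open import Relation.Binary.PropositionalEquality using (_≡_; _≢_)

record Graph (n : ℕ) : Set where
  field
    adj    : Fin n → Fin n → Bool
    sym    : ∀ u v → adj u v ≡ adj v u
    irrefl : ∀ v → adj v v ≡ false

open Graph public

module _ {n : ℕ} (G : Graph n) where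

  Adj : Fin n → Fin n → Set
  Adj u v = T (adj G u v)

  SamePair : Fin n → Fin n → Fin n → Fin n → Set
  SamePair a b c d = (a ≡ c × b ≡ d) ⊎ (a ≡ d × b ≡ c)

  -- A diamond subgraph (not necessarily induced): four distinct vertices
  -- x, y, u, w with the five edges xy, xu, xw, yu, yw (u, w the two
  -- vertices of degree 2 in the diamond).  Distinctness of the other
  -- pairs follows from irreflexivity of adjacency.
  record Diamond : Set where
    field
      x y u w : Fin n
      u≢w : u ≢ w
      xy : Adj x y
      xu : Adj x u
      xw : Adj x w
      yu : Adj y u
      yw : Adj y w

  open Diamond public

  Induced : Diamond → Set
  Induced D = ¬ Adj (u D) (w D)

  record InducedDiamond : Set where
    field
      dia     : Diamond
      induced : Induced dia

  open InducedDiamond public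

  EdgeOf : Diamond → Fin n → Fin n → Set
  EdgeOf D a b =
    SamePair a b (x D) (y D) ⊎ SamePair a b (x D) (u D) ⊎
    SamePair a b (x D) (w D) ⊎ SamePair a b (y D) (u D) ⊎
    SamePair a b (y D) (w D)

  VertexOf : Diamond → Fin n → Set
  VertexOf D v = v ≡ x D ⊎ v ≡ y D ⊎ v ≡ u D ⊎ v ≡ w D

  data PathIn (S : Fin n → Set) : Fin n → Fin n → Set where
    stop : ∀ {a} → S a → PathIn S a a
    step : ∀ {a b c} → S a → Adj a b → PathIn S b c → PathIn S a c

  AllV : Fin n → Set
  AllV _ = ⊤

  NoIrrelevantEdge : Set
  NoIrrelevantEdge = ∀ a b → Adj a b → Σ Diamond λ D → EdgeOf D a b

  CommonNonEdge : Fin n → Fin n → Fin n × Fin n → Set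
  CommonNonEdge a b (p , q) =
    p ≢ q × ¬ Adj p q × Adj a p × Adj b p × Adj a q × Adj b q

  Disjoint : Fin n × Fin n → Fin n × Fin n → Set
  Disjoint (p , q) (p' , q') = p ≢ p' × p ≢ q' × q ≢ p' × q ≢ q'

  NoSunflower : ℕ → Set
  NoSunflower k = ∀ a b → Adj a b →
    ¬ (Σ (Fin (suc k) → Fin n × Fin n) λ f →
         (∀ i → CommonNonEdge a b (f i)) ×
         (∀ i j → i ≢ j → Disjoint (f i) (f j)))

  NoVertexSplit : Set
  NoVertexSplit = ∀ v a b → Adj v a → Adj v b → PathIn (Adj v) a b

  NoIrrelevantComponent : Set
  NoIrrelevantComponent = ∀ v →
    Σ InducedDiamond λ D → PathIn AllV v (x (dia D))

  Reduced : ℕ → Set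
  Reduced k = NoIrrelevantEdge × NoSunflower k × NoVertexSplit ×
              NoIrrelevantComponent

  -- The packing X: a maximal family of at most k pairwise edge-disjoint
  -- induced diamonds, given as  fam : Fin m → InducedDiamond  with m ≤ k.

  EdgeDisjoint : Diamond → Diamond → Set
  EdgeDisjoint D D' = ∀ a b → EdgeOf D a b → ¬ EdgeOf D' a b

  IsMaximalPacking : ℕ → (m : ℕ) → (Fin m → InducedDiamond) → Set
  IsMaximalPacking k m fam =
    m ≤ k ×
    (∀ i j → i ≢ j → EdgeDisjoint (dia (fam i)) (dia (fam j))) ×
    (∀ (D : InducedDiamond) →
       ∃ λ i → ∃ λ a → ∃ λ b → EdgeOf (dia D) a b × EdgeOf (dia (fam i)) a b)

  IsVX : (m : ℕ) → (Fin m → InducedDiamond) → Subset n → Set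
  IsVX m fam VX = ∀ v → (v ∈ VX → ∃ λ i → VertexOf (dia (fam i)) v)
                      × ((∃ λ i → VertexOf (dia (fam i)) v) → v ∈ VX)

  IsMaxCliqueOutside : Subset n → Subset n → Set
  IsMaxCliqueOutside VX C =
    (∀ v → v ∈ C → v ∉ VX) ×
    (∀ a b → a ∈ C → b ∈ C → a ≢ b → Adj a b) ×
    (∀ v → v ∉ VX → v ∉ C → ¬ (∀ c → c ∈ C → Adj v c))

  nbhd : Fin n → Subset n
  nbhd v = tabulate (adj G v)

  exactlyOneIn : Subset n → Fin n → Bool
  exactlyOneIn C v = ∣ C ∩ nbhd v ∣ ≡ᵇ 1

  B : Subset n → Subset n → Subset n
  B VX C = tabulate λ v →
    not (lookup VX v) ∧ not (lookup C v) ∧ exactlyOneIn C v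

  D : Subset n → Subset n → Subset n
  D VX C = tabulate λ v → lookup VX v ∧ exactlyOneIn C v

  attached : Subset n → Subset n → Subset n
  attached VX C = tabulate λ c →
    lookup C c ∧ any (λ v → lookup (B VX C ∪ D VX C) v ∧ adj G c v) (allFin n)

-- Everything rests on one observation: a vertex outside C with two neighbours in C is
-- adjacent to all of C, for otherwise the three of them and a non-neighbour in C form an
-- induced diamond with no edge inside V_X, hence none in X; and then it lies in V_X by
-- maximality of C.  Every attached c ∈ C has a neighbour in D_C: for a neighbour b ∈ B_C,
-- since no vertex split applies, b is joined to the rest of C by a path in G[N(c)], and
-- the first vertex of that path in C ∪ V_X is in D_C.  A vertex of D_C has a unique
-- neighbour in C, so at most |D_C| vertices are attached.  The same path argument yields
-- a vertex of V_X adjacent to all of C, which is not in D_C; so |D_C| < |V_X| ≤ 4m ≤ 4k.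
-- If nothing is attached, k > 0 still holds as G contains an induced diamond.
module Submission where

open import Defs
open import Data.Nat using (ℕ; _≤_; _<_; _*_; _+_; zero; suc; z≤n; s≤s)
import Data.Nat.Properties as ℕ
open import Data.Fin using (Fin; zero; suc; _≟_; combine; remQuot)
open import Data.Fin.Properties using (any?; remQuot-combine)
open import Data.Fin.Subset
  using (Subset; inside; outside; _∈_; _∉_; _∩_; _∪_; ⁅_⁆; _⊆_; _-_; ∣_∣; Nonempty; Empty)
  renaming (⊥ to ∅; ⊤ to full)
open import Data.Fin.Subset.Properties
  using ( _∈?_; p⊆q⇒∣p∣≤∣q∣; x∈p∪q⁺; x∈p∪q⁻; x∈p∩q⁺; x∈p∩q⁻; x∈⁅x⁆
        ; ∣⁅x⁆∣≡1; ∣⊥∣≡0; ∣⊤∣≡n; ∈⊤; x∈p⇒∣p-x∣<∣p∣; x∈p∧x≢y⇒x∈p-y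
        ; nonempty?; Empty-unique )
open import Data.Vec using ([]; _∷_; tabulate; lookup; here; there)
open import Data.Vec.Properties using ([]=⇒lookup; lookup⇒[]=; lookup∘tabulate)
open import Data.Bool using (Bool; T; not; T?)
open import Data.Bool.Properties using (T-∧; T-≡)
open import Data.List using (allFin)
open import Data.List.Relation.Unary.Any using (satisfied)
open import Data.List.Relation.Unary.Any.Properties using (any⁻)
open import Data.Product using (∃; ∃₂; _×_; _,_; proj₁; proj₂)
open import Data.Sum using (_⊎_; inj₁; inj₂; [_,_])
open import Function using (_∘_; _⇔_; mk⇔; Equivalence)
open import Relation.Nullary using (¬_; yes; no; contradiction)
open import Relation.Nullary.Decidable using (_×-dec_; _⊎-dec_; ¬?; decidable-stable)
open import Relation.Unary using (Decidable)
open import Relation.Binary.PropositionalEquality as ≡ using (_≡_; _≢_; refl; subst; cong)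

private
  variable
    m n : ℕ

module _ {p : Subset n} {v : Fin n} where

  T-lookup⇒∈ : T (lookup p v) → v ∈ p
  T-lookup⇒∈ = lookup⇒[]= v p ∘ Equivalence.to T-≡

  T-not-lookup⇒∉ : T (not (lookup p v)) → v ∉ p
  T-not-lookup⇒∉ t v∈p = subst (T ∘ not) ([]=⇒lookup v∈p) t

∈tabulate⇔ : {f : Fin n → Bool} {v : Fin n} → v ∈ tabulate f ⇔ T (f v)
∈tabulate⇔ {f = f} {v} = mk⇔
  (subst T (lookup∘tabulate f v) ∘ Equivalence.from T-≡ ∘ []=⇒lookup)
  (T-lookup⇒∈ ∘ subst T (≡.sym (lookup∘tabulate f v)))

∣p∪q∣≤∣p∣+∣q∣ : (p q : Subset n) → ∣ p ∪ q ∣ ≤ ∣ p ∣ + ∣ q ∣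
∣p∪q∣≤∣p∣+∣q∣ []            []            = z≤n
∣p∪q∣≤∣p∣+∣q∣ (inside  ∷ p) (inside  ∷ q) =
  s≤s (ℕ.≤-trans (∣p∪q∣≤∣p∣+∣q∣ p q) (ℕ.+-monoʳ-≤ ∣ p ∣ (ℕ.n≤1+n ∣ q ∣)))
∣p∪q∣≤∣p∣+∣q∣ (inside  ∷ p) (outside ∷ q) = s≤s (∣p∪q∣≤∣p∣+∣q∣ p q)
∣p∪q∣≤∣p∣+∣q∣ (outside ∷ p) (inside  ∷ q) =
  ℕ.≤-trans (s≤s (∣p∪q∣≤∣p∣+∣q∣ p q)) (ℕ.≤-reflexive (≡.sym (ℕ.+-suc ∣ p ∣ ∣ q ∣)))
∣p∪q∣≤∣p∣+∣q∣ (outside ∷ p) (outside ∷ q) = ∣p∪q∣≤∣p∣+∣q∣ p q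

image : (Fin m → Fin n) → Subset m → Subset n
image f []            = ∅
image f (inside  ∷ p) = ⁅ f zero ⁆ ∪ image (f ∘ suc) p
image f (outside ∷ p) = image (f ∘ suc) p

∣image∣≤ : (f : Fin m → Fin n) (p : Subset m) → ∣ image f p ∣ ≤ ∣ p ∣
∣image∣≤ {n = n} f [] = ℕ.≤-reflexive (∣⊥∣≡0 n)
∣image∣≤ f (inside ∷ p) = ℕ.≤-trans (∣p∪q∣≤∣p∣+∣q∣ ⁅ f zero ⁆ (image (f ∘ suc) p))
  (ℕ.+-mono-≤ (ℕ.≤-reflexive (∣⁅x⁆∣≡1 (f zero))) (∣image∣≤ (f ∘ suc) p))
∣image∣≤ f (outside ∷ p) = ∣image∣≤ (f ∘ suc) p

∈image : (f : Fin m → Fin n) {p : Subset m} {i : Fin m} → i ∈ p → f i ∈ image f p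
∈image f {inside  ∷ p} here         = x∈p∪q⁺ (inj₁ (x∈⁅x⁆ (f zero)))
∈image f {inside  ∷ p} (there i∈p) = x∈p∪q⁺ (inj₂ (∈image (f ∘ suc) i∈p))
∈image f {outside ∷ p} (there i∈p) = ∈image (f ∘ suc) i∈p

covered⇒∣q∣≤∣p∣ : (f : Fin m → Fin n) (p : Subset m) {q : Subset n} →
  (∀ {v} → v ∈ q → ∃ λ i → i ∈ p × f i ≡ v) → ∣ q ∣ ≤ ∣ p ∣
covered⇒∣q∣≤∣p∣ f p cover = ℕ.≤-trans (p⊆q⇒∣p∣≤∣q∣ q⊆image) (∣image∣≤ f p)
  where
  q⊆image : _ ⊆ image f p
  q⊆image v∈q with cover v∈q
  ... | i , i∈p , refl = ∈image f i∈p

x∈p⇒0<∣p∣ : {p : Subset n} {x : Fin n} → x ∈ p → 0 < ∣ p ∣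
x∈p⇒0<∣p∣ x∈p = ℕ.≤-trans (s≤s z≤n) (x∈p⇒∣p-x∣<∣p∣ x∈p)

x∈p⇒∣p∣≡1⊎∃other : {p : Subset n} {x : Fin n} → x ∈ p →
  ∣ p ∣ ≡ 1 ⊎ ∃ λ y → y ∈ p × y ≢ x
x∈p⇒∣p∣≡1⊎∃other {p = p} {x} x∈p with any? (λ y → y ∈? p ×-dec ¬? (y ≟ x))
... | yes other = inj₂ other
... | no ∄other = inj₁ (ℕ.≤-antisym ∣p∣≤1 (x∈p⇒0<∣p∣ x∈p))
  where
  p⊆⁅x⁆ : p ⊆ ⁅ x ⁆
  p⊆⁅x⁆ {y} y∈p =
    subst (_∈ ⁅ x ⁆) (≡.sym (decidable-stable (y ≟ x) (λ y≢x → ∄other (y , y∈p , y≢x)))) (x∈⁅x⁆ x)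
  ∣p∣≤1 : ∣ p ∣ ≤ 1
  ∣p∣≤1 = ℕ.≤-trans (p⊆q⇒∣p∣≤∣q∣ p⊆⁅x⁆) (ℕ.≤-reflexive (∣⁅x⁆∣≡1 x))

Empty⇒∣p∣≡0 : {p : Subset n} → Empty p → ∣ p ∣ ≡ 0
Empty⇒∣p∣≡0 {n} empty = ≡.trans (cong ∣_∣ (Empty-unique empty)) (∣⊥∣≡0 n)

0<∣p∣⇒Nonempty : {p : Subset n} → 0 < ∣ p ∣ → Nonempty p
0<∣p∣⇒Nonempty {p = p} 0<∣p∣ with nonempty? p
... | yes ne    = ne
... | no  empty = contradiction (subst (0 <_) (Empty⇒∣p∣≡0 empty) 0<∣p∣) λ ()

∣p∣≡1⇒x≡y : {p : Subset n} {x y : Fin n} → ∣ p ∣ ≡ 1 → x ∈ p → y ∈ p → x ≡ y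
∣p∣≡1⇒x≡y {x = x} {y} ∣p∣≡1 x∈p y∈p = decidable-stable (x ≟ y) λ x≢y →
  let 2≤∣p∣ = ℕ.≤-trans (s≤s (x∈p⇒0<∣p∣ (x∈p∧x≢y⇒x∈p-y y∈p (x≢y ∘ ≡.sym))))
                        (x∈p⇒∣p-x∣<∣p∣ x∈p)
  in ℕ.>⇒≢ 2≤∣p∣ ∣p∣≡1

elementOr : Subset n → Fin n → Fin n
elementOr p default with nonempty? p
... | yes (x , _) = x
... | no _        = default

∣p∣≡1⇒elementOr≡ : {p : Subset n} {x : Fin n} (default : Fin n) → ∣ p ∣ ≡ 1 → x ∈ p →
  elementOr p default ≡ x
∣p∣≡1⇒elementOr≡ {p = p} default ∣p∣≡1 x∈p with nonempty? p
... | yes (y , y∈p) = ∣p∣≡1⇒x≡y ∣p∣≡1 y∈p x∈p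
... | no empty      = contradiction (_ , x∈p) empty

module _ {n : ℕ} (G : Graph n) where

  Adj-sym : ∀ {a b} → Adj G a b → Adj G b a
  Adj-sym {a} {b} = subst T (Graph.sym G a b)

  Adj⇒≢ : ∀ {a b} → Adj G a b → a ≢ b
  Adj⇒≢ {a} a~a refl = subst T (irrefl G a) a~a

  PathIn-head : ∀ {S a b} → PathIn G S a b → S a
  PathIn-head (stop s)     = s
  PathIn-head (step s _ _) = s

  PathIn-entry : ∀ {S P : Fin n → Set} {a b} → Decidable P → PathIn G S a b →
    ¬ P a → P b → ∃₂ λ p q → S p × S q × Adj G p q × ¬ P p × P q
  PathIn-entry P? (stop _) ¬Pa Pb = contradiction Pb ¬Pa
  PathIn-entry P? (step {b = a′} Sa a~a′ rest) ¬Pa Pb with P? a′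
  ... | yes Pa′ = _ , a′ , Sa , PathIn-head rest , a~a′ , ¬Pa , Pa′
  ... | no ¬Pa′ = PathIn-entry P? rest ¬Pa′ Pb

  module _ (P : Fin n → Set) (Δ : Diamond G) where

    private
      samePair-both : ∀ {a b c d} → P c → P d → SamePair G a b c d → P a × P b
      samePair-both Pc Pd (inj₁ (refl , refl)) = Pc , Pd
      samePair-both Pc Pd (inj₂ (refl , refl)) = Pd , Pc

      samePair-touches : ∀ {a b c d} → P c ⊎ P d → SamePair G a b c d → P a ⊎ P b
      samePair-touches Pcd (inj₁ (refl , refl)) = Pcd
      samePair-touches Pcd (inj₂ (refl , refl)) = [ inj₂ , inj₁ ] Pcd

    edgeOf-both : P (x Δ) → P (y Δ) → P (u Δ) → P (w Δ) →
      ∀ {a b} → EdgeOf G Δ a b → P a × P b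
    edgeOf-both Px Py Pu Pw (inj₁ e)                     = samePair-both Px Py e
    edgeOf-both Px Py Pu Pw (inj₂ (inj₁ e))              = samePair-both Px Pu e
    edgeOf-both Px Py Pu Pw (inj₂ (inj₂ (inj₁ e)))       = samePair-both Px Pw e
    edgeOf-both Px Py Pu Pw (inj₂ (inj₂ (inj₂ (inj₁ e)))) = samePair-both Py Pu e
    edgeOf-both Px Py Pu Pw (inj₂ (inj₂ (inj₂ (inj₂ e)))) = samePair-both Py Pw e

    edgeOf-touches : P (x Δ) ⊎ P (y Δ) → P (x Δ) ⊎ P (u Δ) → P (x Δ) ⊎ P (w Δ) →
      P (y Δ) ⊎ P (u Δ) → P (y Δ) ⊎ P (w Δ) → ∀ {a b} → EdgeOf G Δ a b → P a ⊎ P b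
    edgeOf-touches xy xu xw yu yw (inj₁ e)                     = samePair-touches xy e
    edgeOf-touches xy xu xw yu yw (inj₂ (inj₁ e))              = samePair-touches xu e
    edgeOf-touches xy xu xw yu yw (inj₂ (inj₂ (inj₁ e)))       = samePair-touches xw e
    edgeOf-touches xy xu xw yu yw (inj₂ (inj₂ (inj₂ (inj₁ e)))) = samePair-touches yu e
    edgeOf-touches xy xu xw yu yw (inj₂ (inj₂ (inj₂ (inj₂ e)))) = samePair-touches yw e

  HasEdgeIn : Subset n → Diamond G → Set
  HasEdgeIn S Δ = ∃₂ λ a b → EdgeOf G Δ a b × a ∈ S × b ∈ S

  corner : Diamond G → Fin 4 → Fin n
  corner Δ zero                   = x Δ
  corner Δ (suc zero)             = y Δ
  corner Δ (suc (suc zero))       = u Δ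
  corner Δ (suc (suc (suc zero))) = w Δ

  vertexOf⇒corner : ∀ Δ {v} → VertexOf G Δ v → ∃ λ r → corner Δ r ≡ v
  vertexOf⇒corner _ (inj₁ refl)               = zero , refl
  vertexOf⇒corner _ (inj₂ (inj₁ refl))        = suc zero , refl
  vertexOf⇒corner _ (inj₂ (inj₂ (inj₁ refl))) = suc (suc zero) , refl
  vertexOf⇒corner _ (inj₂ (inj₂ (inj₂ refl))) = suc (suc (suc zero)) , refl

  module _ {m : ℕ} {fam : Fin m → InducedDiamond G} {VX : Subset n}
           (isVX : IsVX G m fam VX) where

    ∣VX∣≤m*4 : ∣ VX ∣ ≤ m * 4
    ∣VX∣≤m*4 = ℕ.≤-trans (covered⇒∣q∣≤∣p∣ vertexAt full cover)
                         (ℕ.≤-reflexive (∣⊤∣≡n (m * 4)))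
      where
      vertexAt : Fin (m * 4) → Fin n
      vertexAt j = let (i , r) = remQuot 4 j in corner (dia (fam i)) r
      cover : ∀ {v} → v ∈ VX → ∃ λ j → j ∈ full × vertexAt j ≡ v
      cover {v} v∈VX with proj₁ (isVX v) v∈VX
      ... | i , v∈Δᵢ with vertexOf⇒corner (dia (fam i)) v∈Δᵢ
      ... | r , refl = combine i r , ∈⊤ , cong (λ (i , r) → corner (dia (fam i)) r) (remQuot-combine i r)

    maximalPacking⇒hasEdgeIn : ∀ {k} → IsMaximalPacking G k m fam →
      ∀ Δ → Induced G Δ → HasEdgeIn VX Δ
    maximalPacking⇒hasEdgeIn (_ , _ , maximal) Δ ind
      with maximal (record { dia = Δ ; induced = ind })
    ... | i , a , b , ab∈Δ , ab∈Δᵢ = a , b , ab∈Δ , edgeOf-both (_∈ VX) Δᵢ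
          (inVX (inj₁ refl)) (inVX (inj₂ (inj₁ refl)))
          (inVX (inj₂ (inj₂ (inj₁ refl)))) (inVX (inj₂ (inj₂ (inj₂ refl)))) ab∈Δᵢ
      where
      Δᵢ = dia (fam i)
      inVX : ∀ {v} → VertexOf G Δᵢ v → v ∈ VX
      inVX v∈Δᵢ = proj₂ (isVX _) (i , v∈Δᵢ)

module CliqueNeighbourhood {n : ℕ} (G : Graph n) (VX C : Subset n)
  (hasEdgeIn : ∀ Δ → Induced G Δ → HasEdgeIn G VX Δ)
  (clique : IsMaxCliqueOutside G VX C) where

  private
    C⇒∉VX : ∀ {c} → c ∈ C → c ∉ VX
    C⇒∉VX = proj₁ clique _

    C-adj : ∀ {a b} → a ∈ C → b ∈ C → a ≢ b → Adj G a b
    C-adj = proj₁ (proj₂ clique) _ _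

  Complete : Fin n → Set
  Complete v = ∀ c → c ∈ C → Adj G v c

  nbhdIn-C : Fin n → Subset n
  nbhdIn-C d = C ∩ nbhd G d

  ∈nbhdIn-C⁺ : ∀ {d c} → c ∈ C → Adj G d c → c ∈ nbhdIn-C d
  ∈nbhdIn-C⁺ c∈C d~c = x∈p∩q⁺ (c∈C , Equivalence.from ∈tabulate⇔ d~c)

  ∈nbhdIn-C⁻ : ∀ {d c} → c ∈ nbhdIn-C d → c ∈ C × Adj G d c
  ∈nbhdIn-C⁻ {d} c∈N with x∈p∩q⁻ C (nbhd G d) c∈N
  ... | c∈C , c∈nbhd = c∈C , Equivalence.to ∈tabulate⇔ c∈nbhd

  edgesLeaveVX⇒tipsAdjacent : (Δ : Diamond G) → let P = _∉ VX in
    P (x Δ) ⊎ P (y Δ) → P (x Δ) ⊎ P (u Δ) → P (x Δ) ⊎ P (w Δ) →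
    P (y Δ) ⊎ P (u Δ) → P (y Δ) ⊎ P (w Δ) → Adj G (u Δ) (w Δ)
  edgesLeaveVX⇒tipsAdjacent Δ xy xu xw yu yw = decidable-stable (T? _) λ ind →
    let (a , b , ab∈Δ , a∈VX , b∈VX) = hasEdgeIn Δ ind in
    [ contradiction a∈VX , contradiction b∈VX ]
      (edgeOf-touches G (_∉ VX) Δ xy xu xw yu yw ab∈Δ)

  twoNeighbours⇒complete : ∀ {v a b} → v ∉ C → a ∈ C → b ∈ C → a ≢ b →
    Adj G v a → Adj G v b → Complete v
  twoNeighbours⇒complete {v} {a} {b} v∉C a∈C b∈C a≢b v~a v~b c c∈C =
    decidable-stable (T? _) λ v≁c → v≁c
      (edgesLeaveVX⇒tipsAdjacent (Δ v≁c) (inj₁ a∉) (inj₁ a∉) (inj₁ a∉) (inj₁ b∉) (inj₁ b∉))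
    where
    a∉ = C⇒∉VX a∈C
    b∉ = C⇒∉VX b∈C
    Δ : ¬ Adj G v c → Diamond G
    Δ v≁c = record
      { x = a ; y = b ; u = v ; w = c ; u≢w = λ { refl → v∉C c∈C }
      ; xy = C-adj a∈C b∈C a≢b ; xu = Adj-sym G v~a ; xw = C-adj a∈C c∈C λ { refl → v≁c v~a }
      ; yu = Adj-sym G v~b ; yw = C-adj b∈C c∈C λ { refl → v≁c v~b } }

  complete⇒∈VX : ∀ {v} → v ∉ C → Complete v → v ∈ VX
  complete⇒∈VX {v} v∉C v~C =
    decidable-stable (v ∈? VX) λ v∉VX → proj₂ (proj₂ clique) v v∉VX v∉C v~C

  twoNeighbours⇒∈VX : ∀ {v a b} → v ∉ C → a ∈ C → b ∈ C → a ≢ b →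
    Adj G v a → Adj G v b → v ∈ VX
  twoNeighbours⇒∈VX v∉C a∈C b∈C a≢b v~a v~b =
    complete⇒∈VX v∉C (twoNeighbours⇒complete v∉C a∈C b∈C a≢b v~a v~b)

  ∈B⁻ : ∀ {v} → v ∈ B G VX C → v ∉ VX × v ∉ C
  ∈B⁻ v∈B =
    let (v∉VX , rest) = Equivalence.to T-∧ (Equivalence.to ∈tabulate⇔ v∈B) in
    T-not-lookup⇒∉ v∉VX , T-not-lookup⇒∉ (proj₁ (Equivalence.to T-∧ rest))

  ∈D⁻ : ∀ {d} → d ∈ D G VX C → d ∈ VX × ∣ nbhdIn-C d ∣ ≡ 1
  ∈D⁻ d∈D =
    let (d∈VX , one) = Equivalence.to T-∧ (Equivalence.to ∈tabulate⇔ d∈D) in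
    T-lookup⇒∈ d∈VX , ℕ.≡ᵇ⇒≡ _ 1 one

  ∈D⁺ : ∀ {d} → d ∈ VX → ∣ nbhdIn-C d ∣ ≡ 1 → d ∈ D G VX C
  ∈D⁺ {d} d∈VX one = Equivalence.from ∈tabulate⇔
    (Equivalence.from T-∧ (Equivalence.from T-≡ ([]=⇒lookup d∈VX) , ℕ.≡⇒≡ᵇ _ 1 one))

  ∈attached⁻ : ∀ {c} → c ∈ attached G VX C →
    c ∈ C × ∃ λ v → v ∈ B G VX C ∪ D G VX C × Adj G c v
  ∈attached⁻ c∈A =
    let (c∈C , attachment) = Equivalence.to T-∧ (Equivalence.to ∈tabulate⇔ c∈A)
        (v , v∈B∪D∧c~v)    = satisfied (any⁻ _ (allFin _) attachment)
        (v∈B∪D , c~v)      = Equivalence.to T-∧ v∈B∪D∧c~v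
    in T-lookup⇒∈ c∈C , v , T-lookup⇒∈ v∈B∪D , c~v

  pathEnteringC⇒complete : ∀ {c b c′} → c ∈ C → PathIn G (Adj G c) b c′ → b ∉ C → c′ ∈ C →
    ∃ λ v → v ∉ C × Complete v
  pathEnteringC⇒complete c∈C path b∉C c′∈C with PathIn-entry G (_∈? C) path b∉C c′∈C
  ... | p , q , c~p , c~q , p~q , p∉C , q∈C =
    p , p∉C , twoNeighbours⇒complete p∉C c∈C q∈C (Adj⇒≢ G c~q) (Adj-sym G c~p) p~q

  -- A second neighbour a ∈ C of q would form a diamond with spine cq and tips a, p;
  -- its edges all leave V_X, so a ~ p and p is complete to C, i.e. p ∈ V_X.
  commonNeighbour⇒∈D : ∀ {c p q} → c ∈ C → p ∉ C → p ∉ VX → q ∈ VX →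
    Adj G c p → Adj G c q → Adj G p q → q ∈ D G VX C
  commonNeighbour⇒∈D {c} {p} {q} c∈C p∉C p∉VX q∈VX c~p c~q p~q
    with x∈p⇒∣p∣≡1⊎∃other (∈nbhdIn-C⁺ c∈C (Adj-sym G c~q))
  ... | inj₁ one = ∈D⁺ q∈VX one
  ... | inj₂ (a , a∈N , a≢c) =
    contradiction (twoNeighbours⇒∈VX p∉C c∈C a∈C (a≢c ∘ ≡.sym) (Adj-sym G c~p) (Adj-sym G a~p)) p∉VX
    where
    a∈C = proj₁ (∈nbhdIn-C⁻ a∈N)
    c∉VX = C⇒∉VX c∈C
    Δ : Diamond G
    Δ = record { x = c ; y = q ; u = a ; w = p ; u≢w = λ { refl → p∉C a∈C }
               ; xy = c~q ; xu = C-adj c∈C a∈C (a≢c ∘ ≡.sym) ; xw = c~p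
               ; yu = proj₂ (∈nbhdIn-C⁻ a∈N) ; yw = Adj-sym G p~q }
    a~p = edgesLeaveVX⇒tipsAdjacent Δ
            (inj₁ c∉VX) (inj₁ c∉VX) (inj₁ c∉VX) (inj₂ (C⇒∉VX a∈C)) (inj₂ p∉VX)

  pathEnteringC∪VX⇒D-neighbour : ∀ {c b c′} → c ∈ C → PathIn G (Adj G c) b c′ →
    b ∉ C → b ∉ VX → c′ ∈ C → ∃ λ d → d ∈ D G VX C × Adj G c d
  pathEnteringC∪VX⇒D-neighbour c∈C path b∉C b∉VX c′∈C
    with PathIn-entry G (λ v → v ∈? C ⊎-dec v ∈? VX) path [ b∉C , b∉VX ] (inj₁ c′∈C)
  ... | p , q , c~p , c~q , p~q , p∉C∪VX , inj₁ q∈C =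
    contradiction (twoNeighbours⇒∈VX (p∉C∪VX ∘ inj₁) c∈C q∈C (Adj⇒≢ G c~q) (Adj-sym G c~p) p~q)
                  (p∉C∪VX ∘ inj₂)
  ... | p , q , c~p , c~q , p~q , p∉C∪VX , inj₂ q∈VX =
    q , commonNeighbour⇒∈D c∈C (p∉C∪VX ∘ inj₁) (p∉C∪VX ∘ inj₂) q∈VX c~p c~q p~q , c~q

  module _ (noSplit : NoVertexSplit G) (2≤∣C∣ : 2 ≤ ∣ C ∣) where

    private
      pathInNbhdToC : ∀ {c v} → c ∈ C → Adj G c v → ∃ λ c′ → c′ ∈ C × PathIn G (Adj G c) v c′
      pathInNbhdToC c∈C c~v with x∈p⇒∣p∣≡1⊎∃other c∈C
      ... | inj₁ ∣C∣≡1 = contradiction ∣C∣≡1 (ℕ.>⇒≢ 2≤∣C∣)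
      ... | inj₂ (c′ , c′∈C , c′≢c) =
        c′ , c′∈C , noSplit _ _ _ c~v (C-adj c∈C c′∈C (c′≢c ∘ ≡.sym))

    attached⇒D-neighbour : ∀ {c} → c ∈ attached G VX C →
      c ∈ C × ∃ λ d → d ∈ D G VX C × Adj G c d
    attached⇒D-neighbour c∈A with ∈attached⁻ c∈A
    ... | c∈C , v , v∈B∪D , c~v with x∈p∪q⁻ (B G VX C) (D G VX C) v∈B∪D
    ...   | inj₂ v∈D = c∈C , v , v∈D , c~v
    ...   | inj₁ v∈B with pathInNbhdToC c∈C c~v
    ...     | c′ , c′∈C , path =
      let (v∉VX , v∉C) = ∈B⁻ v∈B in
      c∈C , pathEnteringC∪VX⇒D-neighbour c∈C path v∉C v∉VX c′∈C

    attached⇒completeInVX : ∀ {c} → c ∈ attached G VX C → ∃ λ q → q ∈ VX × Complete q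
    attached⇒completeInVX c∈A =
      let (c∈C , d , d∈D , c~d) = attached⇒D-neighbour c∈A
          d∉C                   = λ d∈C → C⇒∉VX d∈C (proj₁ (∈D⁻ d∈D))
          (c′ , c′∈C , path)    = pathInNbhdToC c∈C c~d
          (q , q∉C , q~C)       = pathEnteringC⇒complete c∈C path d∉C c′∈C
      in q , complete⇒∈VX q∉C q~C , q~C

    complete⇒∉D : ∀ {q} → Complete q → q ∉ D G VX C
    complete⇒∉D {q} q~C q∈D = ℕ.>⇒≢ 2≤∣N∣ (proj₂ (∈D⁻ q∈D))
      where
      2≤∣N∣ : 2 ≤ ∣ nbhdIn-C q ∣
      2≤∣N∣ = ℕ.≤-trans 2≤∣C∣ (p⊆q⇒∣p∣≤∣q∣ λ c∈C → ∈nbhdIn-C⁺ c∈C (q~C _ c∈C))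

    -- Each attached vertex is the unique C-neighbour of one of its neighbours in D_C.
    ∣attached∣≤∣D∣ : ∣ attached G VX C ∣ ≤ ∣ D G VX C ∣
    ∣attached∣≤∣D∣ = covered⇒∣q∣≤∣p∣ (λ d → elementOr (nbhdIn-C d) d) (D G VX C) λ c∈A →
      let (c∈C , d , d∈D , c~d) = attached⇒D-neighbour c∈A in
      d , d∈D , ∣p∣≡1⇒elementOr≡ d (proj₂ (∈D⁻ d∈D)) (∈nbhdIn-C⁺ c∈C (Adj-sym G c~d))

    ∣attached∣<∣VX∣ : InducedDiamond G → ∣ attached G VX C ∣ < ∣ VX ∣
    ∣attached∣<∣VX∣ Δ with nonempty? (attached G VX C)
    ... | no empty =
      let (a , _ , _ , a∈VX , _) = hasEdgeIn (dia Δ) (induced Δ) in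
      subst (_< ∣ VX ∣) (≡.sym (Empty⇒∣p∣≡0 empty)) (x∈p⇒0<∣p∣ a∈VX)
    ... | yes (c , c∈A) =
      let (q , q∈VX , q~C) = attached⇒completeInVX c∈A
          D⊆VX-q : D G VX C ⊆ VX - q
          D⊆VX-q = λ d∈D → x∈p∧x≢y⇒x∈p-y (proj₁ (∈D⁻ d∈D)) λ { refl → complete⇒∉D q~C d∈D }
      in begin-strict
        ∣ attached G VX C ∣ ≤⟨ ∣attached∣≤∣D∣ ⟩
        ∣ D G VX C ∣        ≤⟨ p⊆q⇒∣p∣≤∣q∣ D⊆VX-q ⟩
        ∣ VX - q ∣          <⟨ x∈p⇒∣p-x∣<∣p∣ q∈VX ⟩
        ∣ VX ∣              ∎
      where open ℕ.≤-Reasoning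

lemma11 : ∀ {n : ℕ} (G : Graph n) (k : ℕ) → Reduced G k →
    (m : ℕ) (fam : Fin m → InducedDiamond G) → IsMaximalPacking G k m fam →
    (VX : Subset n) → IsVX G m fam VX →
    (C : Subset n) → IsMaxCliqueOutside G VX C → 3 ≤ ∣ C ∣ →
    ∣ attached G VX C ∣ < 4 * k
lemma11 G k (_ , _ , noSplit , noIrrelevantComponent) m fam packing VX isVX C clique 3≤∣C∣ =
  begin-strict
    ∣ attached G VX C ∣ <⟨ ∣attached∣<∣VX∣ noSplit (ℕ.<⇒≤ 3≤∣C∣) Δ ⟩
    ∣ VX ∣              ≤⟨ ∣VX∣≤m*4 G {fam = fam} isVX ⟩
    m * 4               ≤⟨ ℕ.*-monoˡ-≤ 4 (proj₁ packing) ⟩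
    k * 4               ≡⟨ ℕ.*-comm k 4 ⟩
    4 * k               ∎
  where
  open ℕ.≤-Reasoning
  open CliqueNeighbourhood G VX C (maximalPacking⇒hasEdgeIn G {fam = fam} isVX packing) clique
  Δ : InducedDiamond G
  Δ = proj₁ (noIrrelevantComponent (proj₁ (0<∣p∣⇒Nonempty {p = C} (ℕ.≤-trans (s≤s z≤n) 3≤∣C∣))))
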